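{- Let $A$ be an $\langle (M,a,\bar{b}_n),(N,c,\bar{d}_n)\rangle$-asimulation, and let \[ A' = \{\,\langle(\bar{a'}_m, a';\bar{b'}_l),(\bar{c'}_m, c';\bar{d'}_l)\rangle \mid (a';\bar{b'}_l)A(c';\bar{d'}_l)\,\}. \] Then $A'$ is an $\langle (M,a,\bar{b}_n),(N,c,\bar{d}_n)\rangle_k$-asimulation for any $k \in \mathbb{N}$.
   Context: $\mathbb{N}$ is the set of natural numbers without $0$. Formulas are first-order over a vocabulary $\Sigma = \{R^2,E^2\}\cup\{P^n_m \mid n,m\in\mathbb{N}\}$; $\Theta$ denotes any subset of $\Sigma$ containing $R^2,E^2$. $\bar{x}_n$ denotes a sequence $x_1,\dots,x_n$; $(\bar{x}_n;\bar{y}_m)$ denotes the ordered pair of the tuples $(\bar{x}_n)$ and $(\bar{y}_m)$. For a binary relation $S$, $s\hat{S}t$ abbreviates $sSt\wedge tSs$. An $n$-ary evaluation $\Theta$-point is $(M,a,\bar{b}_n)$ with $M$ a $\Theta$-model and $a,\bar{b}_n\in D(M)$; $M,a,\bar{b}_n\models\varphi(x,\bar{w}_n)$ means $\varphi$ holds under any assignment sending $x\mapsto a$, $w_i\mapsto b_i$. Given two $n$-ary evaluation $\Theta$-points $(M,a,\bar{b}_n)$, $(N,c,\bar{d}_n)$, a relation $A$ between tuples $(a';\bar{b'}_l)$ from one model and $(c';\bar{d'}_l)$ from the other (both directions, any $l\ge 0$) is an $\langle (M,a,\bar{b}_n),(N,c,\bar{d}_n)\rangle$-asimulation iff $(a;\bar{b}_n)A(c;\bar{d}_n)$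 and for all $\alpha,\beta\in\{M,N\}$, whenever $(a';\bar{b'}_l)A(c';\bar{d'}_l)$ with the first tuple in $D(\alpha)$ and the second in $D(\beta)$: (i) for every $P\in\Theta\setminus\{R^2,E^2\}$, $\alpha,a',\bar{b'}_l\models P(x,\bar{w}_l)$ implies $\beta,c',\bar{d'}_l\models P(x,\bar{w}_l)$; (ii) if $c'R^\beta c''$ then there is $a''$ with $a'R^\alpha a''$ and $(c'';\bar{d'}_l)\hat{A}(a'';\bar{b'}_l)$; (iii) if $E^\alpha(a',b'')$ then there is $d''$ with $E^\beta(c',d'')$ and $(a';\bar{b'}_l,b'')A(c';\bar{d'}_l,d'')$; (iv) if $c'R^\beta c''$ and $E^\beta(c'',d'')$ then there are $a'',b''$ with $a'R^\alpha a''$, $E^\alpha(a'',b'')$ and $(a'';\bar{b'}_l,b'')A(c'';\bar{d'}_l,d'')$. An $\langle (M,a,\bar{b}_n),(N,c,\bar{d}_n)\rangle_k$-asimulation is a relation $A$ between tuples $(\bar{a'}_m,a';\bar{b'}_l)$ ($m\ge 0$ extra "world" elements followed by $a'$, and $l\ge0$ objects) from one model and tuples of the same shape from the other, such that $(a;\bar{b}_n)A(c;\bar{d}_n)$ and for all $\alpha,\beta\in\{M,N\}$, whenever $(\bar{a'}_m,a';\bar{b'}_l)A(\bar{c'}_m,c';\bar{d'}_l)$: (1) for every $P\in\Theta\setminus\{R^2,E^2\}$, $\alpha,a',\bar{b'}_l\models P(x,\bar{w}_l)$ implies $\beta,c',\bar{d'}_l\models P(x,\bar{w}_l)$; (2)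 if $m+l<n+k$ and $c'R^\beta c''$, then there is $a''$ with $a'R^\alpha a''$ and $(\bar{c'}_m,c',c'';\bar{d'}_l)\hat{A}(\bar{a'}_m,a',a'';\bar{b'}_l)$; (3) if $m+l<n+k$ and $E^\alpha(a',b'')$, then there is $d''$ with $E^\beta(c',d'')$ and $(\bar{a'}_m,a';\bar{b'}_l,b'')A(\bar{c'}_m,c';\bar{d'}_l,d'')$; (4) if $m+l+1<n+k$, $c'R^\beta c''$ and $E^\beta(c'',d'')$, then there are $a'',b''$ with $a'R^\alpha a''$, $E^\alpha(a'',b'')$ and $(\bar{a'}_m,a',a'';\bar{b'}_l,b'')A(\bar{c'}_m,c',c'';\bar{d'}_l,d'')$. -}

module Defs where

open import Data.Nat using (ℕ; suc; _+_; _<_)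
open import Data.Vec using (Vec; []; _∷ʳ_)
open import Data.Product using (_×_; Σ; ∃)
open import Level using (0ℓ)

-- A Σ-model.  P n m a bs  interprets the predicate letter P^{n+1}_{m+1}
-- (arity n+1, index m+1; the letters P^n_m have n,m ≥ 1) applied to (a, bs).
record Model : Set₁ where
  field
    D  : Set
    R  : D → D → Set
    E  : D → D → Set
    P  : (n m : ℕ) → D → Vec D n → Set

open Model public

-- A signature Θ ⊆ Σ containing R², E² is determined by which letters
-- P^{n+1}_{m+1} it contains:  Θ n m  means  P^{n+1}_{m+1} ∈ Θ.
Signature : Set₁
Signature = ℕ → ℕ → Set

data Side : Set where
  left right : Side

module _ (M N : Model) where

  Mod : Side → Model
  Mod left  = M
  Mod right = N

  Dom : Side → Set
  Dom s = D (Mod s)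

  Rel : Set₁
  Rel = (α β : Side) (l : ℕ) → Dom α → Vec (Dom α) l → Dom β → Vec (Dom β) l → Set

  KRel : Set₁
  KRel = (α β : Side) (m l : ℕ) →
         Vec (Dom α) m → Dom α → Vec (Dom α) l →
         Vec (Dom β) m → Dom β → Vec (Dom β) l → Set

  record IsAsimulation (Θ : Signature) (n : ℕ)
           (a : D M) (b : Vec (D M) n) (c : D N) (d : Vec (D N) n)
           (A : Rel) : Set where
    field
      init : A left right n a b c d
      atoms : ∀ α β l a' b' c' d' → A α β l a' b' c' d' →
              ∀ m → Θ l m → P (Mod α) l m a' b' → P (Mod β) l m c' d'
      forthR : ∀ α β l a' b' c' d' → A α β l a' b' c' d' →
               ∀ c'' → R (Mod β) c' c'' →
               Σ (Dom α) λ a'' → R (Mod α) a' a'' ×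
                 (A β α l c'' d' a'' b' × A α β l a'' b' c'' d')
      backE : ∀ α β l a' b' c' d' → A α β l a' b' c' d' →
              ∀ b'' → E (Mod α) a' b'' →
              Σ (Dom β) λ d'' → E (Mod β) c' d'' ×
                A α β (suc l) a' (b' ∷ʳ b'') c' (d' ∷ʳ d'')
      forthRE : ∀ α β l a' b' c' d' → A α β l a' b' c' d' →
                ∀ c'' d'' → R (Mod β) c' c'' → E (Mod β) c'' d'' →
                Σ (Dom α) λ a'' → Σ (Dom α) λ b'' →
                  R (Mod α) a' a'' × E (Mod α) a'' b'' ×
                  A α β (suc l) a'' (b' ∷ʳ b'') c'' (d' ∷ʳ d'')

  record IsKAsimulation (Θ : Signature) (n : ℕ)
           (a : D M) (b : Vec (D M) n) (c : D N) (d : Vec (D N) n)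
           (k : ℕ) (A : KRel) : Set where
    field
      init : A left right 0 n [] a b [] c d
      atoms : ∀ α β m l ws a' b' vs c' d' → A α β m l ws a' b' vs c' d' →
              ∀ j → Θ l j → P (Mod α) l j a' b' → P (Mod β) l j c' d'
      forthR : ∀ α β m l ws a' b' vs c' d' → A α β m l ws a' b' vs c' d' →
               m + l < n + k →
               ∀ c'' → R (Mod β) c' c'' →
               Σ (Dom α) λ a'' → R (Mod α) a' a'' ×
                 (A β α (suc m) l (vs ∷ʳ c') c'' d' (ws ∷ʳ a') a'' b' ×
                  A α β (suc m) l (ws ∷ʳ a') a'' b' (vs ∷ʳ c') c'' d')
      backE : ∀ α β m l ws a' b' vs c' d' → A α β m l ws a' b' vs c' d' →
              m + l < n + k →
              ∀ b'' → E (Mod α) a' b'' →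
              Σ (Dom β) λ d'' → E (Mod β) c' d'' ×
                A α β m (suc l) ws a' (b' ∷ʳ b'') vs c' (d' ∷ʳ d'')
      forthRE : ∀ α β m l ws a' b' vs c' d' → A α β m l ws a' b' vs c' d' →
                suc (m + l) < n + k →
                ∀ c'' d'' → R (Mod β) c' c'' → E (Mod β) c'' d'' →
                Σ (Dom α) λ a'' → Σ (Dom α) λ b'' →
                  R (Mod α) a' a'' × E (Mod α) a'' b'' ×
                  A α β (suc m) (suc l) (ws ∷ʳ a') a'' (b' ∷ʳ b'') (vs ∷ʳ c') c'' (d' ∷ʳ d'')

  lift : Rel → KRel
  lift A α β m l ws a' b' vs c' d' = A α β l a' b' c' d'

-- The relation A' = lift A relates (ws, a'; b') to (vs, c'; d') exactly when
-- A relates (a'; b') to (c'; d'): the world prefixes ws, vs are ignored.  So A' is a k-asimulation for EVERY k,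
-- including k = 0.
module Submission where

open import Defs
open import Data.Nat using (ℕ; _≤_)
open import Data.Vec using (Vec)

module _ (Θ : Signature) (M N : Model) (n : ℕ)
         {a : D M} {b : Vec (D M) n} {c : D N} {d : Vec (D N) n}
         {A : Rel M N} (isA : IsAsimulation M N Θ n a b c d A) where

  private module A = IsAsimulation isA

  lift-isKAsimulation : (k : ℕ) → IsKAsimulation M N Θ n a b c d k (lift M N A)
  lift-isKAsimulation k = record
    { init    = A.init
    ; atoms   = λ α β _ l _ a' b' _ c' d' →
                  A.atoms α β l a' b' c' d'
    ; forthR  = λ α β _ l _ a' b' _ c' d' related _ →
                  A.forthR α β l a' b' c' d' related
    ; backE   = λ α β _ l _ a' b' _ c' d' related _ →
                  A.backE α β l a' b' c' d' related
    ; forthRE = λ α β _ l _ a' b' _ c' d' related _ →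
                  A.forthRE α β l a' b' c' d' related
    }

lemma5 : (Θ : Signature) (M N : Model) (n : ℕ)
         (a : D M) (b : Vec (D M) n) (c : D N) (d : Vec (D N) n)
         (A : Rel M N) →
         IsAsimulation M N Θ n a b c d A →
         (k : ℕ) → 1 ≤ k →
         IsKAsimulation M N Θ n a b c d k (lift M N A)
lemma5 Θ M N n a b c d A isA k _ = lift-isKAsimulation Θ M N n isA k
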